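{- For every odd $n\geq 3$ and every $m\geq 2$, the generalized closed web $CW_{m,n}$ is harmonious, i.e. $Z_{2mn}$-harmonious.
   Context: The generalized prism $Y_{m,n}$ is the Cartesian product $P_m\Box C_n$ (layers $C^1,\dots,C^m$ of $C_n$ with corresponding vertices of consecutive layers adjacent). The generalized closed web $CW_{m,n}$ is obtained from $Y_{m,n}$ by adding one new vertex joined to every vertex of the top cycle $C^1$; it has $2mn$ edges. A graph $G=(V,E)$ with $q$ edges is $Z_q$-harmonious (harmonious) if there is an injection $f:V\to Z_q$ such that the induced edge labels $w(xy)=f(x)+f(y)\bmod q$ are all distinct (equivalently form a bijection $E\to Z_q$). -}

module Defs where

open import Data.Nat using (ℕ; zero; suc; _+_; _*_)
open import Data.Nat.DivMod using (_%_)
open import Data.Fin using (Fin; toℕ; fromℕ<; inject₁) renaming (suc to fsuc; zero to fzero)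
open import Data.Fin.Properties using ()
open import Data.Nat.DivMod using (m%n<n)
open import Data.Product using (_×_; _,_; Σ)
open import Data.List using (List; []; _∷_; map; concatMap; allFin; length; _++_)
open import Data.List.Relation.Unary.Unique.Propositional using (Unique)
open import Function.Definitions using (Injective)
open import Relation.Binary.PropositionalEquality using (_≡_)

-- A finite (multi)graph given by a vertex type and an explicit list of edges
-- (each edge an unordered pair, recorded as an ordered pair of endpoints).
record Graph : Set₁ where
  field
    Vertex : Set
    edges  : List (Vertex × Vertex)
open Graph public

size : Graph → ℕ
size G = length (edges G)

_+[_]_ : ℕ → (q : ℕ) → ℕ → ℕ
a +[ zero ] b = a + b
a +[ suc q ] b = (a + b) % suc q

edgeLabel : (G : Graph) → (Vertex G → Fin (size G)) → Vertex G × Vertex G → ℕ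
edgeLabel G f (x , y) = toℕ (f x) +[ size G ] toℕ (f y)

Harmonious : Graph → Set
Harmonious G =
  Σ (Vertex G → Fin (size G)) λ f →
    Injective _≡_ _≡_ f × Unique (map (edgeLabel G f) (edges G))

-- Vertices of CW_{m,n}: layer vertices (i , j) with i ∈ Fin m (layer C^{i+1}),
-- j ∈ Fin n (position on the cycle), plus the apex joined to the top cycle.
data CWVertex (m n : ℕ) : Set where
  layer : Fin m → Fin n → CWVertex m n
  apex  : CWVertex m n

cycSucc : {n : ℕ} → Fin n → Fin n
cycSucc {suc n} j = fromℕ< (m%n<n (suc (toℕ j)) (suc n))

cycleEdges : (m n : ℕ) → List (CWVertex m n × CWVertex m n)
cycleEdges m n =
  concatMap (λ i → map (λ j → layer i j , layer i (cycSucc j)) (allFin n)) (allFin m)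

rungEdges : (m n : ℕ) → List (CWVertex m n × CWVertex m n)
rungEdges zero n = []
rungEdges (suc m) n =
  concatMap (λ i → map (λ j → layer (inject₁ i) j , layer (fsuc i) j) (allFin n)) (allFin m)

apexEdges : (m n : ℕ) → List (CWVertex m n × CWVertex m n)
apexEdges zero n = []
apexEdges (suc m) n = map (λ j → apex , layer fzero j) (allFin n)

-- The generalized closed web CW_{m,n} = (P_m □ C_n) + apex on C^1.
CW : ℕ → ℕ → Graph
CW m n = record
  { Vertex = CWVertex m n
  ; edges  = cycleEdges m n ++ rungEdges m n ++ apexEdges m n
  }

-- Labels are read in base M = 2m. Vertex j of layer i (layers counted from 0) gets the
-- digits (j, i), i.e. the value j·M + i, and the apex gets M − 1. Modulo q = nM, the
-- label of an edge then has the low digit 2i on the cycle edges of layer i, 2i + 1 on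
-- the rungs between layers i and i + 1, and 2m − 1 on the apex edges, so the low digit
-- determines the kind of the edge and its layer. The high digit is 2j + 1, 2j or j
-- modulo n respectively, which determines j because 2 is invertible modulo the odd n.
module Submission where

open import Defs
open import Data.Nat using (ℕ; _≤_)
open import Data.Nat.DivMod using (_%_)
open import Relation.Binary.PropositionalEquality using (_≡_)

open import Data.Nat using (zero; suc; _+_; _*_; _∸_; _<_; NonZero; z<s; s<s; s≤s)
open import Data.Nat.Properties
open import Data.Nat.DivMod
open import Data.Nat.Divisibility using (_∣_; divides; >⇒∤)
open import Data.Nat.Coprimality using (Coprime; coprime-divisor; coprime-+; 1-coprimeTo)
open import Data.Nat.Tactic.RingSolver using (solve-∀)
open import Data.Fin using (Fin; toℕ; fromℕ<; inject₁) renaming (suc to fsuc; zero to fzero)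
open import Data.Fin.Properties using (toℕ-fromℕ<; toℕ-inject₁; toℕ-injective; toℕ<n)
open import Data.List using (List; []; _∷_; map; concatMap; allFin; length; _++_; cartesianProductWith)
open import Data.List.Properties using (map-++; map-∘; map-cong; length-++; length-map; length-tabulate)
open import Data.List.Relation.Unary.Unique.Propositional using (Unique)
open import Data.List.Relation.Unary.Unique.Propositional.Properties using (map⁺; ++⁺; cartesianProductWith⁺; allFin⁺)
open import Data.List.Relation.Binary.Disjoint.Propositional using (Disjoint)
open import Data.List.Membership.Propositional.Properties using (∈-++⁻; ∈-map⁻; ∈-cartesianProductWith⁻)
open import Data.Product using (_×_; _,_; proj₁; proj₂)
open import Data.Sum using (inj₁; inj₂)
open import Function.Definitions using (Injective)
open import Relation.Binary.PropositionalEquality using (_≢_; refl; sym; trans; cong; cong₂; subst; module ≡-Reasoning)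
open import Relation.Nullary using (contradiction)

m%d≡n%d⇒d∣n∸m : ∀ m n d .{{_ : NonZero d}} → m % d ≡ n % d → d ∣ n ∸ m
m%d≡n%d⇒d∣n∸m m n d eq = divides (n / d ∸ m / d) (begin
  n ∸ m                                     ≡⟨ cong₂ _∸_ (m≡m%n+[m/n]*n n d) (m≡m%n+[m/n]*n m d) ⟩
  (n % d + n / d * d) ∸ (m % d + m / d * d) ≡⟨ cong (λ r → (n % d + n / d * d) ∸ (r + m / d * d)) eq ⟩
  (n % d + n / d * d) ∸ (n % d + m / d * d) ≡⟨ [m+n]∸[m+o]≡n∸o (n % d) _ _ ⟩
  n / d * d ∸ m / d * d                     ≡⟨ *-distribʳ-∸ d (n / d) (m / d) ⟨
  (n / d ∸ m / d) * d                       ∎)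
  where open ≡-Reasoning

∣∧<⇒≡0 : ∀ {d m} → d ∣ m → m < d → m ≡ 0
∣∧<⇒≡0 {m = zero}  _   _   = refl
∣∧<⇒≡0 {m = suc _} d∣m m<d = contradiction d∣m (>⇒∤ m<d)

+-*-injective-mod : ∀ {n a} .{{_ : NonZero n}} → Coprime n a → ∀ c {i j} → i < n → j < n →
                    (c + a * i) % n ≡ (c + a * j) % n → i ≡ j
+-*-injective-mod {n} {a} coprime c {i} {j} i<n j<n eq =
  ≤-antisym (m∸n≡0⇒m≤n (∣∧<⇒≡0 (n∣ (sym eq)) (≤-<-trans (m∸n≤m i j) i<n)))
            (m∸n≡0⇒m≤n (∣∧<⇒≡0 (n∣ eq) (≤-<-trans (m∸n≤m j i) j<n)))
  where
  open ≡-Reasoning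
  n∣ : ∀ {x y} → (c + a * x) % n ≡ (c + a * y) % n → n ∣ y ∸ x
  n∣ {x} {y} eq′ = coprime-divisor coprime (subst (n ∣_) (begin
    (c + a * y) ∸ (c + a * x) ≡⟨ [m+n]∸[m+o]≡n∸o c (a * y) (a * x) ⟩
    a * y ∸ a * x             ≡⟨ *-distribˡ-∸ a y x ⟨
    a * (y ∸ x)               ∎) (m%d≡n%d⇒d∣n∸m _ _ n eq′))

odd⇒coprimeTo-2 : ∀ {n} → n % 2 ≡ 1 → Coprime n 2
odd⇒coprimeTo-2 {n} odd = subst (λ k → Coprime k 2) (sym n≡1+k*2) (1+k*2-coprimeTo-2 (n / 2))
  where
  1+k*2-coprimeTo-2 : ∀ k → Coprime (1 + k * 2) 2
  1+k*2-coprimeTo-2 zero    = 1-coprimeTo 2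
  1+k*2-coprimeTo-2 (suc k) = coprime-+ (1+k*2-coprimeTo-2 k)
  n≡1+k*2 : n ≡ 1 + n / 2 * 2
  n≡1+k*2 = trans (m≡m%n+[m/n]*n n 2) (cong (_+ n / 2 * 2) odd)

[m+n%d]%d≡[m+n]%d : ∀ m n d .{{_ : NonZero d}} → (m + n % d) % d ≡ (m + n) % d
[m+n%d]%d≡[m+n]%d m n d = begin
  (m + n % d) % d           ≡⟨ %-distribˡ-+ m (n % d) d ⟩
  (m % d + n % d % d) % d   ≡⟨ cong (λ r → (m % d + r) % d) (m%n%n≡m%n n d) ⟩
  (m % d + n % d) % d       ≡⟨ %-distribˡ-+ m n d ⟨
  (m + n) % d               ∎
  where open ≡-Reasoning

module _ {M : ℕ} where

  digits-< : ∀ {n h l} → h < n → l < M → h * M + l < n * M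
  digits-< {n} {h} {l} h<n l<M = begin-strict
    h * M + l  <⟨ +-monoʳ-< (h * M) l<M ⟩
    h * M + M  ≡⟨ +-comm (h * M) M ⟩
    suc h * M  ≤⟨ *-monoˡ-≤ M h<n ⟩
    n * M      ∎
    where open ≤-Reasoning

  module _ .{{_ : NonZero M}} where

    digits-injective : ∀ {h h′ l l′} → l < M → l′ < M → h * M + l ≡ h′ * M + l′ → h ≡ h′ × l ≡ l′
    digits-injective {h} {h′} {l} {l′} l<M l′<M eq =
      *-cancelʳ-≡ h h′ M (+-cancelʳ-≡ l (h * M) (h′ * M) (trans eq (cong (h′ * M +_) (sym l≡l′)))) , l≡l′
      where
      open ≡-Reasoning
      l≡l′ : l ≡ l′
      l≡l′ = begin
        l                 ≡⟨ m<n⇒m%n≡m l<M ⟨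
        l % M             ≡⟨ [m+kn]%n≡m%n l h M ⟨
        (l + h * M) % M   ≡⟨ cong (_% M) (+-comm l (h * M)) ⟩
        (h * M + l) % M   ≡⟨ cong (_% M) eq ⟩
        (h′ * M + l′) % M ≡⟨ cong (_% M) (+-comm (h′ * M) l′) ⟩
        (l′ + h′ * M) % M ≡⟨ [m+kn]%n≡m%n l′ h′ M ⟩
        l′ % M            ≡⟨ m<n⇒m%n≡m l′<M ⟩
        l′                ∎

    digits-mod : ∀ {h l} n .{{_ : NonZero n}} .{{_ : NonZero (n * M)}} → l < M →
                 (h * M + l) % (n * M) ≡ h % n * M + l
    digits-mod {h} n l<M =
      trans ([m*n+o]%[p*n]≡[m*n]%[p*n]+o h n l<M) (cong (_+ _) (sym (m%n*o≡m*o%[n*o] h n M)))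

    digits-mod-injective : ∀ {h h′ l l′} n .{{_ : NonZero n}} .{{_ : NonZero (n * M)}} → l < M → l′ < M →
                           (h * M + l) % (n * M) ≡ (h′ * M + l′) % (n * M) → h % n ≡ h′ % n × l ≡ l′
    digits-mod-injective n l<M l′<M eq =
      digits-injective l<M l′<M (trans (sym (digits-mod n l<M)) (trans eq (digits-mod n l′<M)))

module _ {A B C : Set} (f : A → B → C) where

  concatMap-map≡cartesianProductWith : ∀ xs ys → concatMap (λ x → map (f x) ys) xs ≡ cartesianProductWith f xs ys
  concatMap-map≡cartesianProductWith []       ys = refl
  concatMap-map≡cartesianProductWith (x ∷ xs) ys = cong (map (f x) ys ++_) (concatMap-map≡cartesianProductWith xs ys)

  map-cartesianProductWith : ∀ {D : Set} (g : C → D) xs ys →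
                             map g (cartesianProductWith f xs ys) ≡ cartesianProductWith (λ x y → g (f x y)) xs ys
  map-cartesianProductWith g []       ys = refl
  map-cartesianProductWith g (x ∷ xs) ys =
    trans (map-++ g (map (f x) ys) _) (cong₂ _++_ (sym (map-∘ ys)) (map-cartesianProductWith g xs ys))

  length-cartesianProductWith : ∀ xs ys → length (cartesianProductWith f xs ys) ≡ length xs * length ys
  length-cartesianProductWith []       ys = refl
  length-cartesianProductWith (x ∷ xs) ys =
    trans (length-++ (map (f x) ys)) (cong₂ _+_ (length-map (f x) ys) (length-cartesianProductWith xs ys))

length-allFin : ∀ n → length (allFin n) ≡ n
length-allFin n = length-tabulate (λ i → i)

+[]≡% : ∀ a q .{{_ : NonZero q}} b → a +[ q ] b ≡ (a + b) % q
+[]≡% a (suc q) b = refl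

harmonious-fromℕ-labelling : ∀ (G : Graph) {q} .{{_ : NonZero q}} → size G ≡ q →
  (val : Vertex G → ℕ) → (∀ v → val v < q) → (∀ {u v} → val u ≡ val v → u ≡ v) →
  Unique (map (λ e → (val (proj₁ e) + val (proj₂ e)) % q) (edges G)) → Harmonious G
harmonious-fromℕ-labelling G refl val val<q val-injective unique =
  f , f-injective , subst Unique (map-cong label≡edgeLabel (edges G)) unique
  where
  f : Vertex G → Fin (size G)
  f v = fromℕ< (val<q v)
  toℕ-f : ∀ v → toℕ (f v) ≡ val v
  toℕ-f v = toℕ-fromℕ< (val<q v)
  f-injective : Injective _≡_ _≡_ f
  f-injective {u} {v} eq = val-injective (trans (sym (toℕ-f u)) (trans (cong toℕ eq) (toℕ-f v)))
  label≡edgeLabel : ∀ e → (val (proj₁ e) + val (proj₂ e)) % size G ≡ edgeLabel G f e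
  label≡edgeLabel (u , v) =
    trans (cong₂ (λ a b → (a + b) % size G) (sym (toℕ-f u)) (sym (toℕ-f v))) (sym (+[]≡% _ (size G) _))

cycleEdge : ∀ {m n} → Fin m → Fin n → CWVertex m n × CWVertex m n
cycleEdge i j = layer i j , layer i (cycSucc j)

rungEdge : ∀ {m n} → Fin m → Fin n → CWVertex (suc m) n × CWVertex (suc m) n
rungEdge i j = layer (inject₁ i) j , layer (fsuc i) j

apexEdge : ∀ {m n} → Fin n → CWVertex (suc m) n × CWVertex (suc m) n
apexEdge j = apex , layer fzero j

toℕ-cycSucc : ∀ {n} (j : Fin (suc n)) → toℕ (cycSucc j) ≡ suc (toℕ j) % suc n
toℕ-cycSucc {n} j = toℕ-fromℕ< (m%n<n (suc (toℕ j)) (suc n))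

edges-CW : ∀ m n → edges (CW (suc m) n) ≡
  cartesianProductWith cycleEdge (allFin (suc m)) (allFin n) ++
  cartesianProductWith rungEdge (allFin m) (allFin n) ++ map apexEdge (allFin n)
edges-CW m n =
  cong₂ _++_ (concatMap-map≡cartesianProductWith cycleEdge (allFin (suc m)) (allFin n))
             (cong (_++ apexEdges (suc m) n) (concatMap-map≡cartesianProductWith rungEdge (allFin m) (allFin n)))

size-CW : ∀ m n → size (CW m n) ≡ n * (2 * m)
size-CW zero    n = sym (*-zeroʳ n)
size-CW (suc m) n = begin
  length (edges (CW (suc m) n))                  ≡⟨ cong length (edges-CW m n) ⟩
  length (cycles ++ rungs ++ apexes)             ≡⟨ length-++ cycles ⟩
  length cycles + length (rungs ++ apexes)       ≡⟨ cong (length cycles +_) (length-++ rungs) ⟩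
  length cycles + (length rungs + length apexes) ≡⟨ cong₂ _+_ (grid-length (suc m) cycleEdge)
                                                      (cong₂ _+_ (grid-length m rungEdge) apexes-length) ⟩
  suc m * n + (m * n + n)                        ≡⟨ arithmetic m n ⟩
  n * (2 * suc m)                                ∎
  where
  open ≡-Reasoning
  Edges = List (CWVertex (suc m) n × CWVertex (suc m) n)
  cycles rungs apexes : Edges
  cycles = cartesianProductWith cycleEdge (allFin (suc m)) (allFin n)
  rungs  = cartesianProductWith rungEdge (allFin m) (allFin n)
  apexes = map apexEdge (allFin n)
  grid-length : ∀ a {C : Set} (e : Fin a → Fin n → C) →
                length (cartesianProductWith e (allFin a) (allFin n)) ≡ a * n
  grid-length a e =
    trans (length-cartesianProductWith e (allFin a) (allFin n)) (cong₂ _*_ (length-allFin a) (length-allFin n))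
  apexes-length : length apexes ≡ n
  apexes-length = trans (length-map apexEdge (allFin n)) (length-allFin n)
  arithmetic : ∀ m n → suc m * n + (m * n + n) ≡ n * (2 * suc m)
  arithmetic = solve-∀

module CW-labelling (m′ n′ : ℕ) (n-coprime-2 : Coprime (suc n′) 2) where

  private
    m = suc m′
    n = suc n′
    M = 2 * m
    q = n * M

  value : CWVertex m n → ℕ
  value (layer i j) = toℕ j * M + toℕ i
  value apex        = suc (2 * m′)

  label : CWVertex m n × CWVertex m n → ℕ
  label e = (value (proj₁ e) + value (proj₂ e)) % q

  apex-digit<M : suc (2 * m′) < M
  apex-digit<M = ≤-reflexive (sym (*-suc 2 m′))

  layer-digit<apex-digit : ∀ (i : Fin m) → toℕ i < suc (2 * m′)
  layer-digit<apex-digit i = <-≤-trans (toℕ<n i) (s≤s (m≤n*m m′ 2))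

  layer-digit<M : ∀ (i : Fin m) → toℕ i < M
  layer-digit<M i = <-trans (layer-digit<apex-digit i) apex-digit<M

  value-< : ∀ v → value v < q
  value-< (layer i j) = digits-< {n = n} (toℕ<n j) (layer-digit<M i)
  value-< apex        = digits-< {n = n} {h = 0} z<s apex-digit<M

  value-injective : ∀ {u v} → value u ≡ value v → u ≡ v
  value-injective {layer i j} {layer i′ j′} eq
    with j≡j′ , i≡i′ ← digits-injective {h = toℕ j} {h′ = toℕ j′} (layer-digit<M i) (layer-digit<M i′) eq =
    cong₂ layer (toℕ-injective i≡i′) (toℕ-injective j≡j′)
  value-injective {layer i j} {apex} eq = contradiction
    (proj₂ (digits-injective {h = toℕ j} {h′ = 0} (layer-digit<M i) apex-digit<M eq))
    (<⇒≢ (layer-digit<apex-digit i))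
  value-injective {apex} {layer i j} eq = contradiction
    (proj₂ (digits-injective {h = 0} {h′ = toℕ j} apex-digit<M (layer-digit<M i) eq))
    (>⇒≢ (layer-digit<apex-digit i))
  value-injective {apex} {apex} eq = refl

  record Digits (e : CWVertex m n × CWVertex m n) : Set where
    field
      high low : ℕ
      low<M    : low < M
      sum≡     : value (proj₁ e) + value (proj₂ e) ≡ high * M + low
  open Digits

  cycle-digits : ∀ i j → Digits (cycleEdge i j)
  cycle-digits i j = record
    { high = toℕ j + toℕ (cycSucc j) ; low = 2 * toℕ i
    ; low<M = *-monoʳ-< 2 (toℕ<n i) ; sum≡ = arithmetic M (toℕ j) (toℕ (cycSucc j)) (toℕ i) }
    where
    arithmetic : ∀ M a b c → (a * M + c) + (b * M + c) ≡ (a + b) * M + 2 * c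
    arithmetic = solve-∀

  rung-digits : ∀ i j → Digits (rungEdge i j)
  rung-digits i j = record
    { high = 2 * toℕ j ; low = suc (2 * toℕ i)
    ; low<M = <-trans (s<s (*-monoʳ-< 2 (toℕ<n i))) apex-digit<M
    ; sum≡ = trans (cong (λ a → (toℕ j * M + a) + value (layer (fsuc i) j)) (toℕ-inject₁ i))
                   (arithmetic M (toℕ j) (toℕ i)) }
    where
    arithmetic : ∀ M a c → (a * M + c) + (a * M + suc c) ≡ (2 * a) * M + suc (2 * c)
    arithmetic = solve-∀

  apex-digits : ∀ j → Digits (apexEdge j)
  apex-digits j = record
    { high = toℕ j ; low = suc (2 * m′) ; low<M = apex-digit<M ; sum≡ = arithmetic M (toℕ j) m′ }
    where
    arithmetic : ∀ M a c → suc (2 * c) + (a * M + 0) ≡ a * M + suc (2 * c)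
    arithmetic = solve-∀

  label-digits : ∀ {e e′} (d : Digits e) (d′ : Digits e′) → label e ≡ label e′ →
                  high d % n ≡ high d′ % n × low d ≡ low d′
  label-digits d d′ eq = digits-mod-injective {h = high d} {h′ = high d′} n (low<M d) (low<M d′)
    (trans (cong (_% q) (sym (sum≡ d))) (trans eq (cong (_% q) (sum≡ d′))))

  cycleLabel : Fin m → Fin n → ℕ
  cycleLabel i j = label (cycleEdge i j)

  rungLabel : Fin m′ → Fin n → ℕ
  rungLabel i j = label (rungEdge i j)

  apexLabel : Fin n → ℕ
  apexLabel j = label (apexEdge j)

  cycle-high-digit : ∀ j → (toℕ j + toℕ (cycSucc j)) % n ≡ (1 + 2 * toℕ j) % n
  cycle-high-digit j = begin
    (toℕ j + toℕ (cycSucc j)) % n ≡⟨ cong (λ k → (toℕ j + k) % n) (toℕ-cycSucc {n′} j) ⟩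
    (toℕ j + suc (toℕ j) % n) % n ≡⟨ [m+n%d]%d≡[m+n]%d (toℕ j) (suc (toℕ j)) n ⟩
    (toℕ j + suc (toℕ j)) % n     ≡⟨ cong (_% n) (arithmetic (toℕ j)) ⟩
    (1 + 2 * toℕ j) % n           ∎
    where
    open ≡-Reasoning
    arithmetic : ∀ a → a + suc a ≡ 1 + 2 * a
    arithmetic a = trans (+-suc a a) (cong (λ b → suc (a + b)) (sym (+-identityʳ a)))

  cycle-label-injective : ∀ {i i′ j j′} → cycleLabel i j ≡ cycleLabel i′ j′ → i ≡ i′ × j ≡ j′
  cycle-label-injective {i} {i′} {j} {j′} eq =
    toℕ-injective (*-cancelˡ-≡ (toℕ i) (toℕ i′) 2 (proj₂ digits≡)) ,
    toℕ-injective (+-*-injective-mod {n} {2} n-coprime-2 1 (toℕ<n j) (toℕ<n j′)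
                    (trans (sym (cycle-high-digit j)) (trans (proj₁ digits≡) (cycle-high-digit j′))))
    where
    digits≡ : (toℕ j + toℕ (cycSucc j)) % n ≡ (toℕ j′ + toℕ (cycSucc j′)) % n
            × 2 * toℕ i ≡ 2 * toℕ i′
    digits≡ = label-digits (cycle-digits i j) (cycle-digits i′ j′) eq

  rung-label-injective : ∀ {i i′ j j′} → rungLabel i j ≡ rungLabel i′ j′ → i ≡ i′ × j ≡ j′
  rung-label-injective {i} {i′} {j} {j′} eq =
    toℕ-injective (*-cancelˡ-≡ (toℕ i) (toℕ i′) 2 (suc-injective (proj₂ digits≡))) ,
    toℕ-injective (+-*-injective-mod {n} {2} n-coprime-2 0 (toℕ<n j) (toℕ<n j′) (proj₁ digits≡))
    where
    digits≡ : (2 * toℕ j) % n ≡ (2 * toℕ j′) % n × suc (2 * toℕ i) ≡ suc (2 * toℕ i′)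
    digits≡ = label-digits (rung-digits i j) (rung-digits i′ j′) eq

  apex-label-injective : ∀ {j j′} → apexLabel j ≡ apexLabel j′ → j ≡ j′
  apex-label-injective {j} {j′} eq = toℕ-injective (begin
    toℕ j      ≡⟨ m<n⇒m%n≡m (toℕ<n j) ⟨
    toℕ j % n  ≡⟨ proj₁ (label-digits (apex-digits j) (apex-digits j′) eq) ⟩
    toℕ j′ % n ≡⟨ m<n⇒m%n≡m (toℕ<n j′) ⟩
    toℕ j′     ∎)
    where open ≡-Reasoning

  cycle≢rung : ∀ i j i′ j′ → cycleLabel i j ≢ rungLabel i′ j′
  cycle≢rung i j i′ j′ eq =
    even≢odd (toℕ i) (toℕ i′) (proj₂ (label-digits (cycle-digits i j) (rung-digits i′ j′) eq))

  cycle≢apex : ∀ i j j′ → cycleLabel i j ≢ apexLabel j′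
  cycle≢apex i j j′ eq =
    even≢odd (toℕ i) m′ (proj₂ (label-digits (cycle-digits i j) (apex-digits j′) eq))

  rung≢apex : ∀ i j j′ → rungLabel i j ≢ apexLabel j′
  rung≢apex i j j′ eq = <⇒≢ (*-monoʳ-< 2 (toℕ<n i))
    (suc-injective (proj₂ (label-digits (rung-digits i j) (apex-digits j′) eq)))

  cycleLabels rungLabels apexLabels : List ℕ
  cycleLabels = cartesianProductWith cycleLabel (allFin m) (allFin n)
  rungLabels  = cartesianProductWith rungLabel (allFin m′) (allFin n)
  apexLabels  = map apexLabel (allFin n)

  labels-CW : map label (edges (CW m n)) ≡ cycleLabels ++ rungLabels ++ apexLabels
  labels-CW = begin
    map label (edges (CW m n))                               ≡⟨ cong (map label) (edges-CW m′ n) ⟩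
    map label (cycles ++ rungs ++ apexes)                    ≡⟨ map-++ label cycles (rungs ++ apexes) ⟩
    map label cycles ++ map label (rungs ++ apexes)          ≡⟨ cong (map label cycles ++_) (map-++ label rungs apexes) ⟩
    map label cycles ++ map label rungs ++ map label apexes
      ≡⟨ cong₂ _++_ cycles-labels (cong₂ _++_ rungs-labels apexes-labels) ⟩
    cycleLabels ++ rungLabels ++ apexLabels                  ∎
    where
    open ≡-Reasoning
    Edges = List (CWVertex m n × CWVertex m n)
    cycles rungs apexes : Edges
    cycles = cartesianProductWith cycleEdge (allFin m) (allFin n)
    rungs  = cartesianProductWith rungEdge (allFin m′) (allFin n)
    apexes = map apexEdge (allFin n)
    cycles-labels : map label cycles ≡ cycleLabels
    cycles-labels = map-cartesianProductWith cycleEdge label (allFin m) (allFin n)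
    rungs-labels : map label rungs ≡ rungLabels
    rungs-labels = map-cartesianProductWith rungEdge label (allFin m′) (allFin n)
    apexes-labels : map label apexes ≡ apexLabels
    apexes-labels = sym (map-∘ (allFin n))

  rung-apex-disjoint : Disjoint rungLabels apexLabels
  rung-apex-disjoint (v∈R , v∈A)
    with i , j , _ , _ , refl ← ∈-cartesianProductWith⁻ rungLabel (allFin m′) (allFin n) v∈R
       | j′ , _ , eq ← ∈-map⁻ apexLabel {xs = allFin n} v∈A = rung≢apex i j j′ eq

  cycle-disjoint : Disjoint cycleLabels (rungLabels ++ apexLabels)
  cycle-disjoint (v∈C , v∈R++A)
    with i , j , _ , _ , refl ← ∈-cartesianProductWith⁻ cycleLabel (allFin m) (allFin n) v∈C
       | ∈-++⁻ rungLabels v∈R++A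
  ... | inj₁ v∈R with i′ , j′ , _ , _ , eq ← ∈-cartesianProductWith⁻ rungLabel (allFin m′) (allFin n) v∈R =
    cycle≢rung i j i′ j′ eq
  ... | inj₂ v∈A with j′ , _ , eq ← ∈-map⁻ apexLabel {xs = allFin n} v∈A =
    cycle≢apex i j j′ eq

  labels-unique : Unique (cycleLabels ++ rungLabels ++ apexLabels)
  labels-unique =
    ++⁺ (cartesianProductWith⁺ cycleLabel cycle-label-injective (allFin⁺ m) (allFin⁺ n))
        (++⁺ (cartesianProductWith⁺ rungLabel rung-label-injective (allFin⁺ m′) (allFin⁺ n))
             (map⁺ apex-label-injective (allFin⁺ n))
             rung-apex-disjoint)
        cycle-disjoint

  CW-harmonious : Harmonious (CW m n)
  CW-harmonious = harmonious-fromℕ-labelling (CW m n) (size-CW m n) value value-< value-injective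
                    (subst Unique (sym labels-CW) labels-unique)

corollary8p4 : (m n : ℕ) → n % 2 ≡ 1 → 3 ≤ n → 2 ≤ m → Harmonious (CW m n)
corollary8p4 zero    _        _     _ ()
corollary8p4 (suc m) zero     ()    _ _
corollary8p4 (suc m) (suc n)  n-odd _ _ = CW-labelling.CW-harmonious m n (odd⇒coprimeTo-2 n-odd)
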